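{- If $\mathcal H$ is an orientably regular hypermap with hypermap subgroup $H$ and chirality index $\kappa$, and $\mathcal H_\Delta$ denotes the orientably regular hypermap with hypermap subgroup $H\cap H^r$, then $\chi(\mathcal H_\Delta)=\kappa\,\chi(\mathcal H)$.
   Context: Let $\Delta=\langle r_0,r_1,r_2\mid r_0^2=r_1^2=r_2^2=1\rangle$ and let $\Delta^+$ be its index-$2$ subgroup of even-length words, generated by $\rho=r_1r_2$ and $\lambda=r_2r_0$. An (oriented) hypermap is a triple $\mathcal H=(D,R,L)$ with $D$ a finite set and $R,L$ permutations of $D$ such that $\langle R,L\rangle$ is transitive on $D$. If $m,n,k$ are the orders of $RL$, $R$, $L$, its Euler characteristic is $\chi(\mathcal H)=|D|(1/m+1/n+1/k-1)$. It is orientably regular if its automorphism group (permutations of $D$ commuting with $R$ and $L$) acts regularly on $D$; then $\mathcal H\cong(\Delta^+/H,\rho,\lambda)$ (left multiplication on cosets) for a unique normal subgroup $H$ of finite index in $\Delta^+$ (the hypermap subgroup). For $H\trianglelefteq\Delta^+$ put $H^r=r_2Hr_2$. The chirality index is $\kappa=|HH^r/H|$. -}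

module Defs where

open import Data.Nat using (ℕ; zero; suc; _<_; _≤_)
open import Data.Integer using (ℤ; +_)
open import Data.Rational using (ℚ; _/_; _+_; _-_; _*_; 0ℚ; 1ℚ)
open import Data.Fin using (Fin)
open import Data.Fin.Subset using (Subset; _∈_; ∣_∣)
open import Data.Fin.Permutation using (Permutation′; _⟨$⟩ʳ_; _⟨$⟩ˡ_)
open import Data.List using (List; []; _∷_; map; _++_)
open import Data.Product using (Σ; ∃; ∃-syntax; _×_; _,_)
open import Function using (_∘_; _⇔_)
open import Relation.Binary.PropositionalEquality using (_≡_)

-- Letters of words in the free group Δ⁺ = ⟨ρ , λ⟩ (Δ⁺ is free of rank 2).
data Gen : Set where
  ρ ρ⁻ λ′ λ′⁻ : Gen

Word : Set
Word = List Gen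

-- conjugation by r₂ : r₂ ρ r₂ = ρ⁻¹ , r₂ λ r₂ = λ⁻¹ (applied letterwise)
conjGen : Gen → Gen
conjGen ρ = ρ⁻
conjGen ρ⁻ = ρ
conjGen λ′ = λ′⁻
conjGen λ′⁻ = λ′

conjWord : Word → Word
conjWord = map conjGen

record Hypermap : Set where
  field
    n : ℕ
    R : Permutation′ n
    L : Permutation′ n

  genAct : Gen → Fin n → Fin n
  genAct ρ d = R ⟨$⟩ʳ d
  genAct ρ⁻ d = R ⟨$⟩ˡ d
  genAct λ′ d = L ⟨$⟩ʳ d
  genAct λ′⁻ d = L ⟨$⟩ˡ d

  -- left action of Δ⁺ on darts (ρ ↦ R, λ ↦ L); word concatenation is the group product
  act : Word → Fin n → Fin n
  act [] d = d
  act (g ∷ w) d = genAct g (act w d)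

  RL : Fin n → Fin n
  RL d = R ⟨$⟩ʳ (L ⟨$⟩ʳ d)

open Hypermap public

Transitive : Hypermap → Set
Transitive 𝓗 = ∀ d e → ∃[ w ] act 𝓗 w d ≡ e

IsAut : (𝓗 : Hypermap) → Permutation′ (n 𝓗) → Set
IsAut 𝓗 φ = ∀ d → (φ ⟨$⟩ʳ (R 𝓗 ⟨$⟩ʳ d) ≡ R 𝓗 ⟨$⟩ʳ (φ ⟨$⟩ʳ d))
                × (φ ⟨$⟩ʳ (L 𝓗 ⟨$⟩ʳ d) ≡ L 𝓗 ⟨$⟩ʳ (φ ⟨$⟩ʳ d))

OrientablyRegular : Hypermap → Set
OrientablyRegular 𝓗 =
  Transitive 𝓗
  × (∀ d e → ∃[ φ ] IsAut 𝓗 φ × φ ⟨$⟩ʳ d ≡ e)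
  × (∀ φ ψ → IsAut 𝓗 φ → IsAut 𝓗 ψ → ∀ d → φ ⟨$⟩ʳ d ≡ ψ ⟨$⟩ʳ d
       → ∀ x → φ ⟨$⟩ʳ x ≡ ψ ⟨$⟩ʳ x)

SubsetΔ⁺ : Set₁
SubsetΔ⁺ = Word → Set

-- H is the hypermap subgroup of 𝓗 with respect to base dart d:
-- H is the stabiliser of d (so 𝓗 ≅ (Δ⁺/H, ρ, λ) via wH ↦ w·d).
IsHypermapSubgroupAt : (𝓗 : Hypermap) → SubsetΔ⁺ → Fin (n 𝓗) → Set
IsHypermapSubgroupAt 𝓗 H d = ∀ w → H w ⇔ (act 𝓗 w d ≡ d)

IsHypermapSubgroup : Hypermap → SubsetΔ⁺ → Set
IsHypermapSubgroup 𝓗 H = ∃[ d ] IsHypermapSubgroupAt 𝓗 H d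

-- H^r = r₂ H r₂
_ʳ : SubsetΔ⁺ → SubsetΔ⁺
(H ʳ) w = H (conjWord w)

_∩_ : SubsetΔ⁺ → SubsetΔ⁺ → SubsetΔ⁺
(H ∩ K) w = H w × K w

_·_ : SubsetΔ⁺ → SubsetΔ⁺ → SubsetΔ⁺
(H · K) w = ∃[ u ] ∃[ v ] H u × K v × w ≡ u ++ v

-- κ = |H H^r / H|, where H is the stabiliser of the dart d: the cosets wH
-- (w ∈ H H^r) correspond bijectively to the darts w·d, so κ is the size of
-- the set { w·d | w ∈ H H^r }.
IsChiralityIndex : (𝓗 : Hypermap) → SubsetΔ⁺ → Fin (n 𝓗) → ℕ → Set
IsChiralityIndex 𝓗 H d κ = Σ (Subset (n 𝓗)) λ S →
  (∀ e → (e ∈ S) ⇔ (∃[ w ] (H · (H ʳ)) w × act 𝓗 w d ≡ e)) × ∣ S ∣ ≡ κ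

iter : ∀ {m} → ℕ → (Fin m → Fin m) → Fin m → Fin m
iter zero f x = x
iter (suc k) f x = f (iter k f x)

IsOrder : ∀ {m} → (Fin m → Fin m) → ℕ → Set
IsOrder f k = 0 < k × (∀ x → iter k f x ≡ x)
              × (∀ j → 0 < j → (∀ x → iter j f x ≡ x) → k ≤ j)

recip : ℕ → ℚ
recip zero = 0ℚ
recip (suc k) = + 1 / suc k

fromℕ : ℕ → ℚ
fromℕ k = + k / 1

IsEulerChar : Hypermap → ℚ → Set
IsEulerChar 𝓗 χ = ∃[ a ] ∃[ b ] ∃[ c ]
  IsOrder (RL 𝓗) a × IsOrder (R 𝓗 ⟨$⟩ʳ_) b × IsOrder (L 𝓗 ⟨$⟩ʳ_) c
  × χ ≡ fromℕ (n 𝓗) * (recip a + recip b + recip c - 1ℚ)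

-- Let K = H ∩ Hʳ, the stabiliser of d′ in 𝓗Δ. Two words agree on d′ in 𝓗Δ iff they
-- agree on d in 𝓗 and so do their r₂-conjugates. Dart stabilisers of a regular hypermap
-- are kernels, so a word acts trivially on 𝓗Δ iff it and its conjugate act trivially
-- on 𝓗; for ρ, λ and ρλ the conjugate is conjugate to the inverse, hence R, L and RL
-- have the same orders in 𝓗 and 𝓗Δ. Finally |Δ⁺ : K| = |Δ⁺ : H| · |H : K|, and h ↦ hʳ·d
-- identifies H/K with the orbit Hʳ·d = HHʳ·d, which has κ elements.

{-# OPTIONS --safe #-}
module Submission where

open import Defs
open import Data.Nat using (ℕ)
open import Data.Rational using (ℚ; _*_)
open import Data.Fin using (Fin)
open import Relation.Binary.PropositionalEquality using (_≡_)

open import Level using (0ℓ)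
open import Data.Nat as ℕ using (zero; suc)
open import Data.Nat.Properties using (≤-antisym; *-comm)
open import Data.Nat.Coprimality as Coprimality using (1-coprimeTo)
open import Data.Integer using (+_)
open import Data.Integer.Properties using (pos-*)
open import Data.Rational using (mkℚ; _/_; _+_; _-_; 1ℚ)
open import Data.Rational.Properties using (↥p/↧p≡p; *-assoc)
open import Data.Fin using (zero; suc; combine; remQuot)
open import Data.Fin.Properties using (suc-injective; combine-injective; combine-remQuot; cantor-schröder-bernstein)
open import Data.Fin.Subset using (Subset; inside; outside; _∈_; ∣_∣)
open import Data.Fin.Permutation using (Permutation′; _⟨$⟩ʳ_; _⟨$⟩ˡ_; inverseˡ; inverseʳ)
open import Data.Vec using (_∷_; here; there)
open import Data.List using ([]; _∷_; _++_)
open import Data.List.Properties using (map-++)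
open import Data.Product using (∃-syntax; _×_; _,_; proj₁; proj₂; uncurry)
open import Data.Product.Properties using (,-injective)
open import Data.Product.Function.NonDependent.Propositional using (_×-⇔_)
open import Function using (_∘_; _⇔_; mk⇔; Equivalence)
open import Function.Definitions using (Injective)
open import Function.Properties.Equivalence using (⇔-setoid)
open import Relation.Binary.PropositionalEquality using (refl; sym; trans; cong; cong₂; subst; module ≡-Reasoning)
import Relation.Binary.Reasoning.Setoid as SetoidReasoning

open Equivalence using (to; from)

module ⇔-Reasoning = SetoidReasoning (⇔-setoid 0ℓ)

act-++ : (G : Hypermap) (u v : Word) (x : Fin (n G)) → act G (u ++ v) x ≡ act G u (act G v x)
act-++ G []      v x = refl
act-++ G (g ∷ u) v x = cong (genAct G g) (act-++ G u v x)

invGen : Gen → Gen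
invGen ρ   = ρ⁻
invGen ρ⁻  = ρ
invGen λ′  = λ′⁻
invGen λ′⁻ = λ′

invWord : Word → Word
invWord []      = []
invWord (g ∷ w) = invWord w ++ invGen g ∷ []

genAct-invGenˡ : (G : Hypermap) (g : Gen) (x : Fin (n G)) → genAct G (invGen g) (genAct G g x) ≡ x
genAct-invGenˡ G ρ   x = inverseˡ (R G)
genAct-invGenˡ G ρ⁻  x = inverseʳ (R G)
genAct-invGenˡ G λ′  x = inverseˡ (L G)
genAct-invGenˡ G λ′⁻ x = inverseʳ (L G)

genAct-invGenʳ : (G : Hypermap) (g : Gen) (x : Fin (n G)) → genAct G g (genAct G (invGen g) x) ≡ x
genAct-invGenʳ G ρ   x = inverseʳ (R G)
genAct-invGenʳ G ρ⁻  x = inverseˡ (R G)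
genAct-invGenʳ G λ′  x = inverseʳ (L G)
genAct-invGenʳ G λ′⁻ x = inverseˡ (L G)

act-invWordˡ : (G : Hypermap) (w : Word) (x : Fin (n G)) → act G (invWord w) (act G w x) ≡ x
act-invWordˡ G []      x = refl
act-invWordˡ G (g ∷ w) x = begin
  act G (invWord w ++ invGen g ∷ []) (genAct G g (act G w x)) ≡⟨ act-++ G (invWord w) _ _ ⟩
  act G (invWord w) (genAct G (invGen g) (genAct G g (act G w x))) ≡⟨ cong (act G (invWord w)) (genAct-invGenˡ G g _) ⟩
  act G (invWord w) (act G w x)                                    ≡⟨ act-invWordˡ G w x ⟩
  x                                                                ∎
  where open ≡-Reasoning

act-invWordʳ : (G : Hypermap) (w : Word) (x : Fin (n G)) → act G w (act G (invWord w) x) ≡ x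
act-invWordʳ G []      x = refl
act-invWordʳ G (g ∷ w) x = begin
  genAct G g (act G w (act G (invWord w ++ invGen g ∷ []) x))      ≡⟨ cong (genAct G g ∘ act G w) (act-++ G (invWord w) _ x) ⟩
  genAct G g (act G w (act G (invWord w) (genAct G (invGen g) x))) ≡⟨ cong (genAct G g) (act-invWordʳ G w _) ⟩
  genAct G g (genAct G (invGen g) x)                               ≡⟨ genAct-invGenʳ G g x ⟩
  x                                                                ∎
  where open ≡-Reasoning

act-injective : (G : Hypermap) (w : Word) → Injective _≡_ _≡_ (act G w)
act-injective G w {x} {y} eq = begin
  x                                   ≡⟨ act-invWordˡ G w x ⟨
  act G (invWord w) (act G w x)       ≡⟨ cong (act G (invWord w)) eq ⟩
  act G (invWord w) (act G w y)       ≡⟨ act-invWordˡ G w y ⟩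
  y                                   ∎
  where open ≡-Reasoning

act-≡⇔ : (G : Hypermap) (u v : Word) (x : Fin (n G))
       → act G u x ≡ act G v x ⇔ act G (invWord v ++ u) x ≡ x
act-≡⇔ G u v x = mk⇔
  (λ eq → trans (act-++ G (invWord v) u x) (trans (cong (act G (invWord v)) eq) (act-invWordˡ G v x)))
  (λ eq → trans (sym (act-invWordʳ G v _)) (cong (act G v) (trans (sym (act-++ G (invWord v) u x)) eq)))

conjGen-involutive : (g : Gen) → conjGen (conjGen g) ≡ g
conjGen-involutive ρ   = refl
conjGen-involutive ρ⁻  = refl
conjGen-involutive λ′  = refl
conjGen-involutive λ′⁻ = refl

conjWord-involutive : (w : Word) → conjWord (conjWord w) ≡ w
conjWord-involutive []      = refl
conjWord-involutive (g ∷ w) = cong₂ _∷_ (conjGen-involutive g) (conjWord-involutive w)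

conjGen-invGen : (g : Gen) → conjGen (invGen g) ≡ invGen (conjGen g)
conjGen-invGen ρ   = refl
conjGen-invGen ρ⁻  = refl
conjGen-invGen λ′  = refl
conjGen-invGen λ′⁻ = refl

conjWord-invWord : (w : Word) → conjWord (invWord w) ≡ invWord (conjWord w)
conjWord-invWord []      = refl
conjWord-invWord (g ∷ w) = trans (map-++ conjGen (invWord w) _)
  (cong₂ _++_ (conjWord-invWord w) (cong (_∷ []) (conjGen-invGen g)))

conjWord-invWord-++ : (u v : Word) → conjWord (invWord u ++ v) ≡ invWord (conjWord u) ++ conjWord v
conjWord-invWord-++ u v = trans (map-++ conjGen (invWord u) v) (cong (_++ conjWord v) (conjWord-invWord u))

act-conjWord-++-conjWord : (G : Hypermap) (u v : Word) (x : Fin (n G))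
  → act G (conjWord (u ++ conjWord v)) x ≡ act G (conjWord u) (act G v x)
act-conjWord-++-conjWord G u v x = begin
  act G (conjWord (u ++ conjWord v)) x              ≡⟨ cong (λ w → act G w x) (map-++ conjGen u (conjWord v)) ⟩
  act G (conjWord u ++ conjWord (conjWord v)) x     ≡⟨ cong (λ w → act G (conjWord u ++ w) x) (conjWord-involutive v) ⟩
  act G (conjWord u ++ v) x                         ≡⟨ act-++ G (conjWord u) v x ⟩
  act G (conjWord u) (act G v x)                    ∎
  where open ≡-Reasoning

AutTransitive : Hypermap → Set
AutTransitive G = ∀ d e → ∃[ φ ] IsAut G φ × φ ⟨$⟩ʳ d ≡ e

ActsTrivially : (G : Hypermap) → Word → Set
ActsTrivially G w = ∀ x → act G w x ≡ x

commutes-inverse : ∀ {m} (π σ : Permutation′ m) → (∀ x → σ ⟨$⟩ʳ (π ⟨$⟩ʳ x) ≡ π ⟨$⟩ʳ (σ ⟨$⟩ʳ x))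
  → ∀ x → σ ⟨$⟩ʳ (π ⟨$⟩ˡ x) ≡ π ⟨$⟩ˡ (σ ⟨$⟩ʳ x)
commutes-inverse π σ σπ≡πσ x = begin
  σ ⟨$⟩ʳ (π ⟨$⟩ˡ x)                          ≡⟨ inverseˡ π ⟨
  π ⟨$⟩ˡ (π ⟨$⟩ʳ (σ ⟨$⟩ʳ (π ⟨$⟩ˡ x)))        ≡⟨ cong (π ⟨$⟩ˡ_) (σπ≡πσ (π ⟨$⟩ˡ x)) ⟨
  π ⟨$⟩ˡ (σ ⟨$⟩ʳ (π ⟨$⟩ʳ (π ⟨$⟩ˡ x)))        ≡⟨ cong (λ y → π ⟨$⟩ˡ (σ ⟨$⟩ʳ y)) (inverseʳ π) ⟩
  π ⟨$⟩ˡ (σ ⟨$⟩ʳ x)                          ∎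
  where open ≡-Reasoning

module _ (G : Hypermap) (φ : Permutation′ (n G)) (φ-aut : IsAut G φ) where

  aut-commutes-genAct : (g : Gen) (x : Fin (n G)) → φ ⟨$⟩ʳ genAct G g x ≡ genAct G g (φ ⟨$⟩ʳ x)
  aut-commutes-genAct ρ   x = proj₁ (φ-aut x)
  aut-commutes-genAct λ′  x = proj₂ (φ-aut x)
  aut-commutes-genAct ρ⁻  x = commutes-inverse (R G) φ (proj₁ ∘ φ-aut) x
  aut-commutes-genAct λ′⁻ x = commutes-inverse (L G) φ (proj₂ ∘ φ-aut) x

  aut-commutes-act : (w : Word) (x : Fin (n G)) → φ ⟨$⟩ʳ act G w x ≡ act G w (φ ⟨$⟩ʳ x)
  aut-commutes-act []      x = refl
  aut-commutes-act (g ∷ w) x = trans (aut-commutes-genAct g _) (cong (genAct G g) (aut-commutes-act w x))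

-- A word fixing e also fixes φ e for every automorphism φ, and these exhaust the darts.
actsTrivially⇔fixes : (G : Hypermap) → AutTransitive G → (w : Word) (e : Fin (n G))
  → ActsTrivially G w ⇔ act G w e ≡ e
actsTrivially⇔fixes G aut w e = mk⇔ (λ triv → triv e) fixes-all
  where
  fixes-all : act G w e ≡ e → ActsTrivially G w
  fixes-all we≡e x with aut e x
  ... | φ , φ-aut , φe≡x = begin
    act G w x            ≡⟨ cong (act G w) φe≡x ⟨
    act G w (φ ⟨$⟩ʳ e)   ≡⟨ aut-commutes-act G φ φ-aut w e ⟨
    φ ⟨$⟩ʳ act G w e     ≡⟨ cong (φ ⟨$⟩ʳ_) we≡e ⟩
    φ ⟨$⟩ʳ e             ≡⟨ φe≡x ⟩
    x                    ∎
    where open ≡-Reasoning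

_HasPeriod_ : ∀ {m} → (Fin m → Fin m) → ℕ → Set
f HasPeriod j = ∀ x → iter j f x ≡ x

module _ {m : ℕ} where

  iter-suc-inner : (f : Fin m → Fin m) (j : ℕ) (x : Fin m) → iter (suc j) f x ≡ iter j f (f x)
  iter-suc-inner f zero    x = refl
  iter-suc-inner f (suc j) x = cong f (iter-suc-inner f j x)

  iter-inverse : {f g : Fin m → Fin m} → (∀ x → g (f x) ≡ x) → (j : ℕ) (x : Fin m)
    → iter j g (iter j f x) ≡ x
  iter-inverse         gf zero    x = refl
  iter-inverse {f} {g} gf (suc j) x = begin
    g (iter j g (iter (suc j) f x))  ≡⟨ cong (g ∘ iter j g) (iter-suc-inner f j x) ⟩
    g (iter j g (iter j f (f x)))    ≡⟨ cong g (iter-inverse gf j (f x)) ⟩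
    g (f x)                          ≡⟨ gf x ⟩
    x                                ∎
    where open ≡-Reasoning

  iter-∘-comm : (a b : Fin m → Fin m) (j : ℕ) (x : Fin m) → iter j (a ∘ b) (a x) ≡ a (iter j (b ∘ a) x)
  iter-∘-comm a b zero    x = refl
  iter-∘-comm a b (suc j) x = cong (a ∘ b) (iter-∘-comm a b j x)

  HasPeriod-inverse : {f g : Fin m → Fin m} → (∀ x → g (f x) ≡ x) → ∀ j → f HasPeriod j → g HasPeriod j
  HasPeriod-inverse {f} {g} gf j f-period x = begin
    iter j g x               ≡⟨ cong (iter j g) (f-period x) ⟨
    iter j g (iter j f x)    ≡⟨ iter-inverse gf j x ⟩
    x                        ∎
    where open ≡-Reasoning

  HasPeriod-rotate : {a a′ : Fin m → Fin m} (b : Fin m → Fin m) → (∀ x → a (a′ x) ≡ x)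
    → ∀ j → (b ∘ a) HasPeriod j → (a ∘ b) HasPeriod j
  HasPeriod-rotate {a} {a′} b aa′ j ba-period x = begin
    iter j (a ∘ b) x            ≡⟨ cong (iter j (a ∘ b)) (aa′ x) ⟨
    iter j (a ∘ b) (a (a′ x))   ≡⟨ iter-∘-comm a b j (a′ x) ⟩
    a (iter j (b ∘ a) (a′ x))   ≡⟨ cong a (ba-period (a′ x)) ⟩
    a (a′ x)                    ≡⟨ aa′ x ⟩
    x                           ∎
    where open ≡-Reasoning

IsOrder-unique : ∀ {m m′} {f : Fin m → Fin m} {g : Fin m′ → Fin m′} {a b : ℕ}
  → (∀ j → f HasPeriod j ⇔ g HasPeriod j) → IsOrder f a → IsOrder g b → a ≡ b
IsOrder-unique {a = a} {b} same (0<a , f-period-a , a-least) (0<b , g-period-b , b-least) =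
  ≤-antisym (a-least b 0<b (from (same b) g-period-b)) (b-least a 0<a (to (same a) f-period-a))

_^ʷ_ : Word → ℕ → Word
w ^ʷ zero  = []
w ^ʷ suc j = w ++ w ^ʷ j

act-^ʷ : (G : Hypermap) (w : Word) (j : ℕ) (x : Fin (n G)) → act G (w ^ʷ j) x ≡ iter j (act G w) x
act-^ʷ G w zero    x = refl
act-^ʷ G w (suc j) x = trans (act-++ G w (w ^ʷ j) x) (cong (act G w) (act-^ʷ G w j x))

conjWord-^ʷ : (w : Word) (j : ℕ) → conjWord (w ^ʷ j) ≡ conjWord w ^ʷ j
conjWord-^ʷ w zero    = refl
conjWord-^ʷ w (suc j) = trans (map-++ conjGen w (w ^ʷ j)) (cong (conjWord w ++_) (conjWord-^ʷ w j))

HasPeriod⇔actsTrivially-^ʷ : (G : Hypermap) (w : Word) (j : ℕ)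
  → act G w HasPeriod j ⇔ ActsTrivially G (w ^ʷ j)
HasPeriod⇔actsTrivially-^ʷ G w j = mk⇔
  (λ period x → trans (act-^ʷ G w j x) (period x))
  (λ triv x → trans (sym (act-^ʷ G w j x)) (triv x))

HasPeriod-invWord : (G : Hypermap) (w : Word) → ∀ j → act G w HasPeriod j → act G (invWord w) HasPeriod j
HasPeriod-invWord G w = HasPeriod-inverse (act-invWordˡ G w)

-- (ρλ)ʳ = ρ⁻¹λ⁻¹ is conjugate, by ρ, to (ρλ)⁻¹ = λ⁻¹ρ⁻¹.
HasPeriod-conjWord-ρλ : (G : Hypermap) → ∀ j
  → act G (ρ ∷ λ′ ∷ []) HasPeriod j → act G (ρ⁻ ∷ λ′⁻ ∷ []) HasPeriod j
HasPeriod-conjWord-ρλ G j ρλ-period =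
  HasPeriod-rotate (act G (λ′⁻ ∷ [])) (act-invWordˡ G (ρ ∷ [])) j (HasPeriod-invWord G (ρ ∷ λ′ ∷ []) j ρλ-period)

enumerate : ∀ {m} (p : Subset m) → Fin ∣ p ∣ → Fin m
enumerate (inside  ∷ p) zero    = zero
enumerate (inside  ∷ p) (suc k) = suc (enumerate p k)
enumerate (outside ∷ p) k       = suc (enumerate p k)

enumerate-∈ : ∀ {m} (p : Subset m) (k : Fin ∣ p ∣) → enumerate p k ∈ p
enumerate-∈ (inside  ∷ p) zero    = here
enumerate-∈ (inside  ∷ p) (suc k) = there (enumerate-∈ p k)
enumerate-∈ (outside ∷ p) k       = there (enumerate-∈ p k)

enumerate-injective : ∀ {m} (p : Subset m) → Injective _≡_ _≡_ (enumerate p)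
enumerate-injective (inside  ∷ p) {zero}  {zero}  eq = refl
enumerate-injective (inside  ∷ p) {suc k} {suc l} eq = cong suc (enumerate-injective p (suc-injective eq))
enumerate-injective (outside ∷ p)                 eq = enumerate-injective p (suc-injective eq)

position : ∀ {m} (p : Subset m) {i : Fin m} → i ∈ p → Fin ∣ p ∣
position (inside  ∷ p) here      = zero
position (inside  ∷ p) (there h) = suc (position p h)
position (outside ∷ p) (there h) = position p h

enumerate-position : ∀ {m} (p : Subset m) {i : Fin m} (i∈p : i ∈ p) → enumerate p (position p i∈p) ≡ i
enumerate-position (inside  ∷ p) here      = refl
enumerate-position (inside  ∷ p) (there h) = cong suc (enumerate-position p h)
enumerate-position (outside ∷ p) (there h) = cong suc (enumerate-position p h)

≡*-from-injections : ∀ {a b c} {f : Fin a → Fin b × Fin c} {g : Fin b × Fin c → Fin a}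
  → Injective _≡_ _≡_ f → Injective _≡_ _≡_ g → a ≡ b ℕ.* c
≡*-from-injections {b = b} {c} f-injective g-injective =
  cantor-schröder-bernstein (f-injective ∘ combine-pair-injective) (remQuot-injective ∘ g-injective)
  where
  combine-pair-injective : ∀ {p q} → uncurry combine p ≡ uncurry combine q → p ≡ q
  combine-pair-injective {i , j} {k , l} eq with combine-injective i j k l eq
  ... | refl , refl = refl
  remQuot-injective : ∀ {i j} → remQuot {b} c i ≡ remQuot c j → i ≡ j
  remQuot-injective {i} {j} eq =
    trans (sym (combine-remQuot {b} c i)) (trans (cong (uncurry combine) eq) (combine-remQuot {b} c j))

module Diagonal (𝓗 : Hypermap) (H : SubsetΔ⁺) (d : Fin (n 𝓗)) (H-stab : IsHypermapSubgroupAt 𝓗 H d)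
                (𝓗Δ : Hypermap) (d′ : Fin (n 𝓗Δ)) (K-stab : IsHypermapSubgroupAt 𝓗Δ (H ∩ (H ʳ)) d′) where

  act-Δ-≡⇔ : (u v : Word) → act 𝓗Δ u d′ ≡ act 𝓗Δ v d′
    ⇔ (act 𝓗 u d ≡ act 𝓗 v d × act 𝓗 (conjWord u) d ≡ act 𝓗 (conjWord v) d)
  act-Δ-≡⇔ u v = begin
    act 𝓗Δ u d′ ≡ act 𝓗Δ v d′
      ≈⟨ act-≡⇔ 𝓗Δ u v d′ ⟩
    act 𝓗Δ (invWord v ++ u) d′ ≡ d′
      ≈⟨ K-stab (invWord v ++ u) ⟨
    (H (invWord v ++ u) × H (conjWord (invWord v ++ u)))
      ≈⟨ H-stab (invWord v ++ u) ×-⇔ H-stab (conjWord (invWord v ++ u)) ⟩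
    (act 𝓗 (invWord v ++ u) d ≡ d × act 𝓗 (conjWord (invWord v ++ u)) d ≡ d)
      ≡⟨ cong (λ w → act 𝓗 (invWord v ++ u) d ≡ d × act 𝓗 w d ≡ d) (conjWord-invWord-++ v u) ⟩
    (act 𝓗 (invWord v ++ u) d ≡ d × act 𝓗 (invWord (conjWord v) ++ conjWord u) d ≡ d)
      ≈⟨ act-≡⇔ 𝓗 u v d ×-⇔ act-≡⇔ 𝓗 (conjWord u) (conjWord v) d ⟨
    (act 𝓗 u d ≡ act 𝓗 v d × act 𝓗 (conjWord u) d ≡ act 𝓗 (conjWord v) d)
      ∎
    where open ⇔-Reasoning

  module _ (H-aut : AutTransitive 𝓗) (K-aut : AutTransitive 𝓗Δ) where

    actsTrivially-Δ⇔ : (w : Word) → ActsTrivially 𝓗Δ w ⇔ (ActsTrivially 𝓗 w × ActsTrivially 𝓗 (conjWord w))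
    actsTrivially-Δ⇔ w = begin
      ActsTrivially 𝓗Δ w
        ≈⟨ actsTrivially⇔fixes 𝓗Δ K-aut w d′ ⟩
      act 𝓗Δ w d′ ≡ d′
        ≈⟨ act-Δ-≡⇔ w [] ⟩
      (act 𝓗 w d ≡ d × act 𝓗 (conjWord w) d ≡ d)
        ≈⟨ actsTrivially⇔fixes 𝓗 H-aut w d ×-⇔ actsTrivially⇔fixes 𝓗 H-aut (conjWord w) d ⟨
      (ActsTrivially 𝓗 w × ActsTrivially 𝓗 (conjWord w))
        ∎
      where open ⇔-Reasoning

    HasPeriod-Δ⇔ : (w : Word) (j : ℕ)
      → act 𝓗Δ w HasPeriod j ⇔ (act 𝓗 w HasPeriod j × act 𝓗 (conjWord w) HasPeriod j)
    HasPeriod-Δ⇔ w j = begin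
      act 𝓗Δ w HasPeriod j
        ≈⟨ HasPeriod⇔actsTrivially-^ʷ 𝓗Δ w j ⟩
      ActsTrivially 𝓗Δ (w ^ʷ j)
        ≈⟨ actsTrivially-Δ⇔ (w ^ʷ j) ⟩
      (ActsTrivially 𝓗 (w ^ʷ j) × ActsTrivially 𝓗 (conjWord (w ^ʷ j)))
        ≡⟨ cong (λ v → ActsTrivially 𝓗 (w ^ʷ j) × ActsTrivially 𝓗 v) (conjWord-^ʷ w j) ⟩
      (ActsTrivially 𝓗 (w ^ʷ j) × ActsTrivially 𝓗 (conjWord w ^ʷ j))
        ≈⟨ HasPeriod⇔actsTrivially-^ʷ 𝓗 w j ×-⇔ HasPeriod⇔actsTrivially-^ʷ 𝓗 (conjWord w) j ⟨
      (act 𝓗 w HasPeriod j × act 𝓗 (conjWord w) HasPeriod j)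
        ∎
      where open ⇔-Reasoning

    IsOrder-Δ≡ : (w : Word) → (∀ j → act 𝓗 w HasPeriod j → act 𝓗 (conjWord w) HasPeriod j)
      → ∀ {p q} → IsOrder (act 𝓗Δ w) p → IsOrder (act 𝓗 w) q → p ≡ q
    IsOrder-Δ≡ w conj-period = IsOrder-unique λ j → mk⇔
      (proj₁ ∘ to (HasPeriod-Δ⇔ w j))
      (λ period → from (HasPeriod-Δ⇔ w j) (period , conj-period j period))

  module Counting (H-trans : Transitive 𝓗) (H-aut : AutTransitive 𝓗) (K-trans : Transitive 𝓗Δ)
                  (S : Subset (n 𝓗)) (S-spec : ∀ e → (e ∈ S) ⇔ (∃[ w ] (H · (H ʳ)) w × act 𝓗 w d ≡ e)) where

    H-actsTrivially : {w : Word} → H w → ActsTrivially 𝓗 w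
    H-actsTrivially {w} w∈H = from (actsTrivially⇔fixes 𝓗 H-aut w d) (to (H-stab w) w∈H)

    ∈S⇔∈Hʳ-orbit : (e : Fin (n 𝓗)) → (e ∈ S) ⇔ (∃[ v ] (H ʳ) v × act 𝓗 v d ≡ e)
    ∈S⇔∈Hʳ-orbit e = begin
      e ∈ S                                    ≈⟨ S-spec e ⟩
      (∃[ w ] (H · (H ʳ)) w × act 𝓗 w d ≡ e)   ≈⟨ mk⇔ drop-H add-H ⟩
      (∃[ v ] (H ʳ) v × act 𝓗 v d ≡ e)         ∎
      where
      open ⇔-Reasoning
      drop-H : (∃[ w ] (H · (H ʳ)) w × act 𝓗 w d ≡ e) → ∃[ v ] (H ʳ) v × act 𝓗 v d ≡ e
      drop-H (_ , (u , v , u∈H , v∈Hʳ , refl) , uvd≡e) =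
        v , v∈Hʳ , trans (sym (H-actsTrivially u∈H _)) (trans (sym (act-++ 𝓗 u v d)) uvd≡e)
      add-H : (∃[ v ] (H ʳ) v × act 𝓗 v d ≡ e) → ∃[ w ] (H · (H ʳ)) w × act 𝓗 w d ≡ e
      add-H (v , v∈Hʳ , vd≡e) = v , ([] , v , from (H-stab []) refl , v∈Hʳ , refl) , vd≡e

    path : Fin (n 𝓗) → Word
    path x = proj₁ (H-trans d x)

    pathΔ : Fin (n 𝓗Δ) → Word
    pathΔ e = proj₁ (K-trans d′ e)

    base : Fin (n 𝓗Δ) → Fin (n 𝓗)
    base e = act 𝓗 (pathΔ e) d

    -- The coset of (path (base e))⁻¹ (pathΔ e) ∈ H modulo H ∩ Hʳ, read off through h ↦ hʳ·d.
    fibre : Fin (n 𝓗Δ) → Fin (n 𝓗)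
    fibre e = act 𝓗 (invWord (conjWord (path (base e)))) (act 𝓗 (conjWord (pathΔ e)) d)

    fibre-∈ : (e : Fin (n 𝓗Δ)) → fibre e ∈ S
    fibre-∈ e = from (∈S⇔∈Hʳ-orbit (fibre e)) (conjWord h , h∈Hʳʳ , hʳd≡fibre)
      where
      h : Word
      h = invWord (path (base e)) ++ pathΔ e
      h∈Hʳʳ : H (conjWord (conjWord h))
      h∈Hʳʳ = subst H (sym (conjWord-involutive h))
        (from (H-stab h) (to (act-≡⇔ 𝓗 (pathΔ e) (path (base e)) d) (sym (proj₂ (H-trans d (base e))))))
      hʳd≡fibre : act 𝓗 (conjWord h) d ≡ fibre e
      hʳd≡fibre = trans (cong (λ w → act 𝓗 w d) (conjWord-invWord-++ (path (base e)) (pathΔ e)))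
                        (act-++ 𝓗 (invWord (conjWord (path (base e)))) (conjWord (pathΔ e)) d)

    toPair : Fin (n 𝓗Δ) → Fin (n 𝓗) × Fin ∣ S ∣
    toPair e = base e , position S (fibre-∈ e)

    toPair-injective : Injective _≡_ _≡_ toPair
    toPair-injective {e} {f} eq with ,-injective eq
    ... | base≡ , position≡ = begin
      e                       ≡⟨ proj₂ (K-trans d′ e) ⟨
      act 𝓗Δ (pathΔ e) d′     ≡⟨ from (act-Δ-≡⇔ (pathΔ e) (pathΔ f)) (base≡ , conj≡) ⟩
      act 𝓗Δ (pathΔ f) d′     ≡⟨ proj₂ (K-trans d′ f) ⟩
      f                       ∎
      where
      open ≡-Reasoning
      fibre≡ : fibre e ≡ fibre f
      fibre≡ = trans (sym (enumerate-position S (fibre-∈ e)))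
                     (trans (cong (enumerate S) position≡) (enumerate-position S (fibre-∈ f)))
      conj≡ : act 𝓗 (conjWord (pathΔ e)) d ≡ act 𝓗 (conjWord (pathΔ f)) d
      conj≡ = act-injective 𝓗 (invWord (conjWord (path (base e)))) (trans fibre≡
        (cong (λ x → act 𝓗 (invWord (conjWord (path x))) (act 𝓗 (conjWord (pathΔ f)) d)) (sym base≡)))

    representative : Fin ∣ S ∣ → Word
    representative k = proj₁ (to (∈S⇔∈Hʳ-orbit _) (enumerate-∈ S k))

    representative-conj∈H : (k : Fin ∣ S ∣) → H (conjWord (representative k))
    representative-conj∈H k = proj₁ (proj₂ (to (∈S⇔∈Hʳ-orbit _) (enumerate-∈ S k)))

    representative-spec : (k : Fin ∣ S ∣) → act 𝓗 (representative k) d ≡ enumerate S k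
    representative-spec k = proj₂ (proj₂ (to (∈S⇔∈Hʳ-orbit _) (enumerate-∈ S k)))

    fromPair : Fin (n 𝓗) × Fin ∣ S ∣ → Fin (n 𝓗Δ)
    fromPair (x , k) = act 𝓗Δ (path x ++ conjWord (representative k)) d′

    fromPair-base : (x : Fin (n 𝓗)) (k : Fin ∣ S ∣) → act 𝓗 (path x ++ conjWord (representative k)) d ≡ x
    fromPair-base x k = trans (act-++ 𝓗 (path x) (conjWord (representative k)) d)
      (trans (cong (act 𝓗 (path x)) (H-actsTrivially (representative-conj∈H k) d)) (proj₂ (H-trans d x)))

    fromPair-fibre : (x : Fin (n 𝓗)) (k : Fin ∣ S ∣)
      → act 𝓗 (conjWord (path x ++ conjWord (representative k))) d ≡ act 𝓗 (conjWord (path x)) (enumerate S k)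
    fromPair-fibre x k = trans (act-conjWord-++-conjWord 𝓗 (path x) (representative k) d)
      (cong (act 𝓗 (conjWord (path x))) (representative-spec k))

    fromPair-injective : Injective _≡_ _≡_ fromPair
    fromPair-injective {x , k} {y , l} eq
      with to (act-Δ-≡⇔ (path x ++ conjWord (representative k)) (path y ++ conjWord (representative l))) eq
    ... | base≡ , conj≡ with refl ← trans (sym (fromPair-base x k)) (trans base≡ (fromPair-base y l)) =
      cong (x ,_) (enumerate-injective S (act-injective 𝓗 (conjWord (path x))
        (trans (sym (fromPair-fibre x k)) (trans conj≡ (fromPair-fibre x l)))))

    darts-Δ≡ : n 𝓗Δ ≡ n 𝓗 ℕ.* ∣ S ∣
    darts-Δ≡ = ≡*-from-injections toPair-injective fromPair-injective

fromℕ≡mkℚ : (m : ℕ) → fromℕ m ≡ mkℚ (+ m) 0 (Coprimality.sym (1-coprimeTo m))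
fromℕ≡mkℚ m = ↥p/↧p≡p (mkℚ (+ m) 0 (Coprimality.sym (1-coprimeTo m)))

fromℕ-* : (p q : ℕ) → fromℕ (p ℕ.* q) ≡ fromℕ p * fromℕ q
fromℕ-* p q rewrite fromℕ≡mkℚ p | fromℕ≡mkℚ q = cong (_/ 1) (pos-* p q)

corollary4 : (𝓗 : Hypermap) → OrientablyRegular 𝓗
    → (H : SubsetΔ⁺) (d : Fin (n 𝓗)) → IsHypermapSubgroupAt 𝓗 H d
    → (κ : ℕ) → IsChiralityIndex 𝓗 H d κ
    → (𝓗Δ : Hypermap) → OrientablyRegular 𝓗Δ → IsHypermapSubgroup 𝓗Δ (H ∩ (H ʳ))
    → (χ χΔ : ℚ) → IsEulerChar 𝓗 χ → IsEulerChar 𝓗Δ χΔ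
    → χΔ ≡ fromℕ κ * χ
corollary4 𝓗 (H-trans , H-aut , _) H d H-stab κ (S , S-spec , ∣S∣≡κ) 𝓗Δ (K-trans , K-aut , _) (d′ , K-stab)
           χ χΔ (a , b , c , a-order , b-order , c-order , χ≡) (aΔ , bΔ , cΔ , aΔ-order , bΔ-order , cΔ-order , χΔ≡)
  = begin
    χΔ                                 ≡⟨ χΔ≡ ⟩
    fromℕ (n 𝓗Δ) * XΔ                  ≡⟨ cong₂ (λ m X → fromℕ m * X) n𝓗Δ≡κ*n𝓗 XΔ≡X ⟩
    fromℕ (κ ℕ.* n 𝓗) * X              ≡⟨ cong (_* X) (fromℕ-* κ (n 𝓗)) ⟩
    fromℕ κ * fromℕ (n 𝓗) * X          ≡⟨ *-assoc (fromℕ κ) (fromℕ (n 𝓗)) X ⟩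
    fromℕ κ * (fromℕ (n 𝓗) * X)        ≡⟨ cong (fromℕ κ *_) χ≡ ⟨
    fromℕ κ * χ                        ∎
  where
  open Diagonal 𝓗 H d H-stab 𝓗Δ d′ K-stab
  open Counting H-trans H-aut K-trans S S-spec
  open ≡-Reasoning
  X XΔ : ℚ
  X  = recip a + recip b + recip c - 1ℚ
  XΔ = recip aΔ + recip bΔ + recip cΔ - 1ℚ
  -- For a single generator g the word gʳ is g⁻¹, so HasPeriod-invWord applies.
  XΔ≡X : XΔ ≡ X
  XΔ≡X rewrite IsOrder-Δ≡ H-aut K-aut (ρ ∷ λ′ ∷ []) (HasPeriod-conjWord-ρλ 𝓗) aΔ-order a-order
             | IsOrder-Δ≡ H-aut K-aut (ρ ∷ []) (HasPeriod-invWord 𝓗 (ρ ∷ [])) bΔ-order b-order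
             | IsOrder-Δ≡ H-aut K-aut (λ′ ∷ []) (HasPeriod-invWord 𝓗 (λ′ ∷ [])) cΔ-order c-order = refl
  n𝓗Δ≡κ*n𝓗 : n 𝓗Δ ≡ κ ℕ.* n 𝓗
  n𝓗Δ≡κ*n𝓗 = trans darts-Δ≡ (trans (*-comm (n 𝓗) ∣ S ∣) (cong (ℕ._* n 𝓗) ∣S∣≡κ))
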